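{- Let $H$ be an undirected graph with $n$ vertices and let $G_{\mathrm{sub}}$ be a graph obtained from $H$ by subdividing each edge at most once. Then $\operatorname{dtw}(G_{\mathrm{sub}})\le \lceil n/2\rceil$.
   Context: Subdividing an edge $\{u,v\}$ means replacing it by a new vertex $w$ and edges $\{u,w\},\{w,v\}$. For a DAG $\vec H$, a source is a vertex of indegree $0$, $S$ is the set of sources, $R(s)$ is the set of vertices reachable from $s$ by a directed path, and $R(B)=\bigcup_{s\in B}R(s)$. A DAG tree decomposition of $\vec H$ is a tree whose nodes are bags $B\subseteq S$ such that every source lies in some bag and, for any bags $B,B_1,B_2$ with $B$ on the unique path between $B_1$ and $B_2$, $R(B_1)\cap R(B_2)\subseteq R(B)$; its width is the maximum bag size and $\operatorname{dtw}(\vec H)$ is the minimum width. For an undirected graph, $\operatorname{dtw}$ is the maximum of $\operatorname{dtw}$ over all its acyclic orientations. -}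

module Defs where

open import Data.Nat using (ℕ; suc; _≤_)
open import Data.Fin using (Fin) renaming (_<_ to _<ᶠ_)
open import Data.Bool using (Bool; true; false)
open import Data.Product using (Σ; ∃; _×_; _,_)
open import Data.Sum using (_⊎_; inj₁; inj₂)
open import Data.Empty using (⊥)
open import Data.List using (List; []; _∷_; length)
open import Data.List.Membership.Propositional using (_∈_)
open import Data.List.Relation.Unary.All using (All)
open import Data.List.Relation.Unary.Unique.Propositional using (Unique)
open import Relation.Nullary using (¬_)
open import Relation.Binary.PropositionalEquality using (_≡_)
open import Relation.Binary.Construct.Closure.ReflexiveTransitive using (Star)

record SimpleGraph (n : ℕ) : Set where
  field
    adj     : Fin n → Fin n → Bool
    sym     : ∀ u v → adj u v ≡ adj v u
    irrefl  : ∀ u → adj u u ≡ false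

record Graph : Set₁ where
  field
    V   : Set
    E   : V → V → Set
    sym : ∀ {u v} → E u v → E v u

-- Subdividing a chosen set of edges of H once each.
-- `sub` selects which edges are subdivided (symmetric; only its values on
-- edges of H matter).

module _ {n : ℕ} (H : SimpleGraph n) (sub : Fin n → Fin n → Bool) where
  open SimpleGraph H

  SubVertex : Set
  SubVertex = Σ (Fin n × Fin n) λ { (u , v) → u <ᶠ v × adj u v ≡ true × sub u v ≡ true }

  SubV : Set
  SubV = Fin n ⊎ SubVertex

  SubE : SubV → SubV → Set
  SubE (inj₁ u) (inj₁ v) = adj u v ≡ true × sub u v ≡ false
  SubE (inj₁ w) (inj₂ ((u , v) , _)) = w ≡ u ⊎ w ≡ v
  SubE (inj₂ ((u , v) , _)) (inj₁ w) = w ≡ u ⊎ w ≡ v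
  SubE (inj₂ _) (inj₂ _) = ⊥

module _ {n : ℕ} (H : SimpleGraph n) (sub : Fin n → Fin n → Bool)
         (sub-sym : ∀ u v → sub u v ≡ sub v u) where
  open SimpleGraph H

  private
    symE : ∀ {x y} → SubE H sub x y → SubE H sub y x
    symE {inj₁ u} {inj₁ v} (a , s) rewrite sym u v | sub-sym u v = a , s
    symE {inj₁ w} {inj₂ _} p = p
    symE {inj₂ _} {inj₁ w} p = p
    symE {inj₂ _} {inj₂ _} ()

  subdivide : Graph
  subdivide = record { V = SubV H sub ; E = SubE H sub ; sym = λ {x} {y} → symE {x} {y} }

module _ (G : Graph) where
  open Graph G

  record AcyclicOrientation : Set₁ where
    field
      D        : V → V → Set
      sound    : ∀ {u v} → D u v → E u v
      complete : ∀ {u v} → E u v → D u v ⊎ D v u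
      antisym  : ∀ {u v} → D u v → ¬ D v u
      acyclic  : ∀ {u v} → D u v → ¬ Star D v u

data Walk {A : Set} (T : A → A → Set) : A → A → List A → Set where
  here : ∀ {x} → Walk T x x (x ∷ [])
  step : ∀ {x y z ps} → T x y → Walk T y z ps → Walk T x z (x ∷ ps)

SimplePath : {A : Set} (T : A → A → Set) → A → A → List A → Set
SimplePath T x y ps = Walk T x y ps × Unique ps

record IsTree (t : ℕ) (T : Fin (suc t) → Fin (suc t) → Set) : Set where
  field
    symT       : ∀ {x y} → T x y → T y x
    irreflT    : ∀ {x} → ¬ T x x
    connected  : ∀ x y → ∃ λ ps → Walk T x y ps
    uniquePath : ∀ {x y ps qs} → SimplePath T x y ps → SimplePath T x y qs → ps ≡ qs

module _ {G : Graph} (O : AcyclicOrientation G) where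
  open Graph G
  open AcyclicOrientation O

  IsSource : V → Set
  IsSource s = ∀ u → ¬ D u s

  InR : List V → V → Set
  InR B v = ∃ λ s → s ∈ B × Star D s v

  record DAGTreeDecomposition : Set₁ where
    field
      t       : ℕ
      T       : Fin (suc t) → Fin (suc t) → Set
      isTree  : IsTree t T
      bag     : Fin (suc t) → List V
      bagUniq : ∀ i → Unique (bag i)
      bagSrc  : ∀ i → All IsSource (bag i)
      cover   : ∀ s → IsSource s → ∃ λ i → s ∈ bag i
      pathCond : ∀ i j l ps → SimplePath T i j ps → l ∈ ps →
                 ∀ v → InR (bag i) v → InR (bag j) v → InR (bag l) v

  WidthAtMost : DAGTreeDecomposition → ℕ → Set
  WidthAtMost dec k = ∀ i → length (DAGTreeDecomposition.bag dec i) ≤ k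

  DagTwAtMost : ℕ → Set₁
  DagTwAtMost k = Σ DAGTreeDecomposition λ dec → WidthAtMost dec k

DtwAtMost : Graph → ℕ → Set₁
DtwAtMost G k = (O : AcyclicOrientation G) → DagTwAtMost O k

{-# OPTIONS --safe #-}
module Submission where

-- A subdivision vertex w has degree two, so when it is a
-- source it reaches both endpoints of its edge. Choose greedily a maximal set M of source
-- subdivision vertices with pairwise disjoint endpoints and deal the n − 2|M| original
-- vertices left uncovered into two halves. Two adjacent central bags each consist of M
-- together with, for every vertex x of one half, a single source equal or adjacent to x;
-- they have at most |M| + ⌈(n − 2|M|)/2⌉ = ⌈n/2⌉ elements. Every source not yet placed is
-- a subdivision vertex w and gets a leaf bag {w}. By maximality at most one endpoint of w
-- is uncovered; hanging the leaf at the central bag of that endpoint's half makes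
-- everything w reaches, apart from w itself, reachable from that central bag, and on a
-- double star this is all the path condition asks.

open import Defs
open import Data.Nat using (ℕ; zero; suc; _+_; _*_; _≤_; z≤n; s≤s; ⌈_/2⌉; ⌊_/2⌋)
open import Data.Nat.Properties
  using (≤-trans; ≤-reflexive; ≰⇒>; _≤?_; ⌊n/2⌋≤⌈n/2⌉; *-suc; +-monoʳ-≤; ⌈n/2⌉-mono; <-irrelevant; module ≤-Reasoning)
open import Data.Fin using (Fin; zero; suc) renaming (_<_ to _<ᶠ_)
open import Data.Fin.Properties using (_≟_; _<?_; <⇒≢; pigeonhole)
open import Data.Bool using (Bool; true; false; not; if_then_else_)
import Data.Bool.Properties as Bool
open import Data.Maybe using (Maybe; just; nothing)
import Data.Maybe.Relation.Unary.All as MaybeAll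
import Data.Maybe.Relation.Unary.Any as MaybeAny
open import Data.Unit using (⊤; tt)
open import Data.Empty using (⊥; ⊥-elim)
open import Data.Product using (∃; _×_; _,_; proj₁; proj₂)
open import Data.Sum using (_⊎_; inj₁; inj₂; [_,_]′; map₂)
open import Data.Sum.Properties using (inj₁-injective; inj₂-injective)
open import Data.List
  using (List; []; _∷_; _++_; length; lookup; map; mapMaybe; concatMap; filter; allFin; cartesianProduct; deduplicate)
open import Data.List.Properties using (length-++; length-map; length-mapMaybe; length-deduplicate)
open import Data.List.Membership.Propositional using (_∈_; _∉_; find; lose)
open import Data.List.Membership.Propositional.Properties
  using (∈-map⁺; ∈-++⁺ˡ; ∈-++⁺ʳ; ∈-filter⁺; ∈-filter⁻; ∈-lookup; ∈-allFin; ∈-cartesianProduct⁺;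
         ∈-deduplicate⁺; ∈-deduplicate⁻; ∈-concatMap⁻)
import Data.List.Membership.DecPropositional as DecMembership
open import Data.List.Relation.Unary.Any as Any using (Any; here; there; index; any?)
open import Data.List.Relation.Unary.Any.Properties using (lookup-index; mapMaybe⁺)
open import Data.List.Relation.Unary.All as All using (All; []; _∷_; all?)
import Data.List.Relation.Unary.All.Properties as All
open import Data.List.Relation.Unary.AllPairs using ([]; _∷_)
open import Data.List.Relation.Unary.Unique.Propositional using (Unique)
import Data.List.Relation.Unary.Unique.Propositional.Properties as Unique
open import Data.List.Relation.Unary.Unique.DecPropositional.Properties using (deduplicate-!)
open import Relation.Nullary using (¬_; Dec; yes; no; ¬?; does)
open import Relation.Nullary.Decidable using (_×-dec_; _⊎-dec_; map′)
open import Relation.Binary.Definitions using (DecidableEquality)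
open import Relation.Binary.PropositionalEquality using (_≡_; _≢_; refl; sym; trans; cong; subst)
open import Relation.Binary.Construct.Closure.ReflexiveTransitive using (Star; ε; _◅_; _◅◅_)
open import Axiom.UniquenessOfIdentityProofs using (module Decidable⇒UIP)
open import Function using (_∘_; _∘′_; id)

private variable
  A B : Set

∈-mapMaybe⁺ : {f : A → Maybe B} {x : A} {y : B} {xs : List A} →
              x ∈ xs → f x ≡ just y → y ∈ mapMaybe f xs
∈-mapMaybe⁺ {f = f} {x} {y} {xs} x∈xs fx≡y = mapMaybe⁺ f xs (Any.map just-y (∈-map⁺ f x∈xs))
  where
  just-y : ∀ {z} → f x ≡ z → MaybeAny.Any (y ≡_) z
  just-y refl = subst (MaybeAny.Any (y ≡_)) (sym fx≡y) (MaybeAny.just refl)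

lookup-injective : ∀ {xs : List A} → Unique xs → ∀ i j → lookup xs i ≡ lookup xs j → i ≡ j
lookup-injective {xs = _ ∷ _} _            zero    zero    _ = refl
lookup-injective {xs = _ ∷ _} (x∉xs ∷ _)   zero    (suc j) e = ⊥-elim (All.lookup x∉xs (∈-lookup j) e)
lookup-injective {xs = _ ∷ _} (x∉xs ∷ _)   (suc i) zero    e = ⊥-elim (All.lookup x∉xs (∈-lookup i) (sym e))
lookup-injective {xs = _ ∷ _} (_ ∷ unique) (suc i) (suc j) e = cong suc (lookup-injective unique i j e)

length-unique-Fin : ∀ {n} {xs : List (Fin n)} → Unique xs → length xs ≤ n
length-unique-Fin {n} {xs} unique with length xs ≤? n
... | yes bounded = bounded
... | no  unbounded with pigeonhole (≰⇒> unbounded) (lookup xs)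
... | i , j , i<j , e = ⊥-elim (<⇒≢ i<j (lookup-injective unique i j e))

everyOther : Bool → List A → List A
everyOther _     []       = []
everyOther true  (x ∷ xs) = x ∷ everyOther false xs
everyOther false (x ∷ xs) = everyOther true xs

length-everyOther-true  : (xs : List A) → length (everyOther true xs) ≡ ⌈ length xs /2⌉
length-everyOther-false : (xs : List A) → length (everyOther false xs) ≡ ⌊ length xs /2⌋
length-everyOther-true  []       = refl
length-everyOther-true  (_ ∷ xs) = cong suc (length-everyOther-false xs)
length-everyOther-false []       = refl
length-everyOther-false (_ ∷ xs) = length-everyOther-true xs

length-everyOther : ∀ b (xs : List A) → length (everyOther b xs) ≤ ⌈ length xs /2⌉
length-everyOther true  xs = ≤-reflexive (length-everyOther-true xs)
length-everyOther false xs = ≤-trans (≤-reflexive (length-everyOther-false xs)) (⌊n/2⌋≤⌈n/2⌉ (length xs))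

∈-everyOther : ∀ {x : A} {xs} → x ∈ xs → x ∈ everyOther true xs ⊎ x ∈ everyOther false xs
∈-everyOther             (here refl) = inj₁ (here refl)
∈-everyOther {xs = _ ∷ _} (there x∈xs) = [ inj₂ , inj₁ ∘ there ]′ (∈-everyOther x∈xs)

⌈2*m+n/2⌉≡m+⌈n/2⌉ : ∀ m n → ⌈ 2 * m + n /2⌉ ≡ m + ⌈ n /2⌉
⌈2*m+n/2⌉≡m+⌈n/2⌉ zero    n = refl
⌈2*m+n/2⌉≡m+⌈n/2⌉ (suc m) n =
  trans (cong (λ k → ⌈ k + n /2⌉) (*-suc 2 m)) (cong suc (⌈2*m+n/2⌉≡m+⌈n/2⌉ m n))

star-into-minimal : ∀ {R : A → A → Set} {x s} → (∀ y → ¬ R y s) → Star R x s → x ≡ s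
star-into-minimal minimal ε          = refl
star-into-minimal minimal (r ◅ r⋆) with star-into-minimal minimal r⋆
... | refl = ⊥-elim (minimal _ r)

1≤⌈n/2⌉ : ∀ {n} → Fin n → 1 ≤ ⌈ n /2⌉
1≤⌈n/2⌉ {suc _} _ = s≤s z≤n

module GreedyMatching {A E : Set} (_≟ᴬ_ : DecidableEquality A) (ends : E → A × A) where

  open DecMembership _≟ᴬ_ using (_∈?_)

  endpoints : E → List A
  endpoints e = proj₁ (ends e) ∷ proj₂ (ends e) ∷ []

  covered : List E → List A
  covered = concatMap endpoints

  Free : List E → E → Set
  Free M e = All (_∉ covered M) (endpoints e)

  free? : ∀ M e → Dec (Free M e)
  free? M e = all? (λ x → ¬? (x ∈? covered M)) (endpoints e)

  extend : List E → List E → List E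
  extend M []       = M
  extend M (e ∷ es) with free? M e
  ... | yes _ = extend (e ∷ M) es
  ... | no  _ = extend M es

  maximalMatching : List E → List E
  maximalMatching = extend []

  ∈-extend : ∀ {e} M es → e ∈ extend M es → e ∈ M ⊎ e ∈ es
  ∈-extend M []       e∈ = inj₁ e∈
  ∈-extend M (e ∷ es) e∈ with free? M e
  ... | no  _ = map₂ there (∈-extend M es e∈)
  ... | yes _ with ∈-extend (e ∷ M) es e∈
  ...   | inj₁ (here refl)  = inj₂ (here refl)
  ...   | inj₁ (there e∈M)  = inj₁ e∈M
  ...   | inj₂ e∈es         = inj₂ (there e∈es)

  covered-extend : ∀ {x} M es → x ∈ covered M → x ∈ covered (extend M es)
  covered-extend M []       x∈ = x∈
  covered-extend M (e ∷ es) x∈ with free? M e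
  ... | yes _ = covered-extend (e ∷ M) es (∈-++⁺ʳ (endpoints e) x∈)
  ... | no  _ = covered-extend M es x∈

  NonLoop : E → Set
  NonLoop e = proj₁ (ends e) ≢ proj₂ (ends e)

  extend-unique : ∀ M es → All NonLoop es → Unique (covered M) → Unique (covered (extend M es))
  extend-unique M []       _                unique = unique
  extend-unique M (e ∷ es) (nonLoop ∷ nonLoops) unique with free? M e
  ... | yes free = extend-unique (e ∷ M) es nonLoops
                     (Unique.++⁺ ((nonLoop ∷ []) ∷ [] ∷ []) unique (λ (x∈e , x∈M) → All.lookup free x∈e x∈M))
  ... | no  _    = extend-unique M es nonLoops unique

  extend-maximal : ∀ {e} M es → e ∈ es → ¬ Free (extend M es) e
  extend-maximal M (e ∷ es) (here refl) free′ with free? M e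
  ... | yes _      = All.lookup free′ (here refl) (covered-extend (e ∷ M) es (here refl))
  ... | no  ¬free  = ¬free (All.map (λ x∉ x∈ → x∉ (covered-extend M es x∈)) free′)
  extend-maximal M (e′ ∷ es) (there e∈es) with free? M e′
  ... | yes _ = extend-maximal (e′ ∷ M) es e∈es
  ... | no  _ = extend-maximal M es e∈es

  ∈-maximalMatching : ∀ {e} es → e ∈ maximalMatching es → e ∈ es
  ∈-maximalMatching es e∈ = [ (λ ()) , id ]′ (∈-extend [] es e∈)

  maximalMatching-unique : ∀ es → All NonLoop es → Unique (covered (maximalMatching es))
  maximalMatching-unique es nonLoops = extend-unique [] es nonLoops []

  maximalMatching-maximal : ∀ {e} es → e ∈ es → ¬ Free (maximalMatching es) e
  maximalMatching-maximal = extend-maximal []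

  length-covered : ∀ M → length (covered M) ≡ 2 * length M
  length-covered []      = refl
  length-covered (e ∷ M) = trans (cong (λ k → suc (suc k)) (length-covered M)) (sym (*-suc 2 (length M)))

module DoubleStar {ℓ : ℕ} (side : Fin ℓ → Bool) where

  Node : Set
  Node = Fin (suc (suc ℓ))

  pattern c₀ = zero
  pattern c₁ = suc zero
  pattern leaf k = suc (suc k)

  centre : Bool → Node
  centre false = c₀
  centre true  = c₁

  Edge : Node → Node → Set
  Edge c₀       c₁       = ⊤
  Edge c₁       c₀       = ⊤
  Edge c₀       (leaf k) = side k ≡ false
  Edge c₁       (leaf k) = side k ≡ true
  Edge (leaf k) c₀       = side k ≡ false
  Edge (leaf k) c₁       = side k ≡ true
  Edge _        _        = ⊥

  parent : Node → Node
  parent (leaf k) = centre (side k)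
  parent x        = x

  edge-sym : ∀ {x y} → Edge x y → Edge y x
  edge-sym {c₀}     {c₁}     e = e
  edge-sym {c₀}     {leaf _} e = e
  edge-sym {c₁}     {c₀}     e = e
  edge-sym {c₁}     {leaf _} e = e
  edge-sym {leaf _} {c₀}     e = e
  edge-sym {leaf _} {c₁}     e = e

  edge-irrefl : ∀ {x} → ¬ Edge x x
  edge-irrefl {c₀}     ()
  edge-irrefl {c₁}     ()
  edge-irrefl {leaf _} ()

  viaCentres : Bool → Bool → Fin ℓ → List Node
  viaCentres false false k = c₀ ∷ leaf k ∷ []
  viaCentres false true  k = c₀ ∷ c₁ ∷ leaf k ∷ []
  viaCentres true  false k = c₁ ∷ c₀ ∷ leaf k ∷ []
  viaCentres true  true  k = c₁ ∷ leaf k ∷ []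

  pathFromCentre : Bool → Node → List Node
  pathFromCentre b     (leaf k) = viaCentres b (side k) k
  pathFromCentre false c₀       = c₀ ∷ []
  pathFromCentre false c₁       = c₀ ∷ c₁ ∷ []
  pathFromCentre true  c₀       = c₁ ∷ c₀ ∷ []
  pathFromCentre true  c₁       = c₁ ∷ []

  path : Node → Node → List Node
  path c₀       y = pathFromCentre false y
  path c₁       y = pathFromCentre true y
  path (leaf k) y with y ≟ leaf k
  ... | yes _ = leaf k ∷ []
  ... | no  _ = leaf k ∷ pathFromCentre (side k) y

  viaCentres-walk : ∀ b s k → side k ≡ s → Walk Edge (centre b) (leaf k) (viaCentres b s k)
  viaCentres-walk false false k e = step e here
  viaCentres-walk false true  k e = step tt (step e here)
  viaCentres-walk true  false k e = step tt (step e here)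
  viaCentres-walk true  true  k e = step e here

  pathFromCentre-walk : ∀ b y → Walk Edge (centre b) y (pathFromCentre b y)
  pathFromCentre-walk false c₀       = here
  pathFromCentre-walk false c₁       = step tt here
  pathFromCentre-walk true  c₀       = step tt here
  pathFromCentre-walk true  c₁       = here
  pathFromCentre-walk b     (leaf k) = viaCentres-walk b (side k) k refl

  edge-to-parent : ∀ k s → side k ≡ s → Edge (leaf k) (centre s)
  edge-to-parent k false e = e
  edge-to-parent k true  e = e

  path-walk : ∀ x y → Walk Edge x y (path x y)
  path-walk c₀       y = pathFromCentre-walk false y
  path-walk c₁       y = pathFromCentre-walk true y
  path-walk (leaf k) y with y ≟ leaf k
  ... | yes refl = here
  ... | no  _    = step (edge-to-parent k (side k) refl) (pathFromCentre-walk (side k) y)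

  path-self : ∀ x → path x x ≡ x ∷ []
  path-self c₀       = refl
  path-self c₁       = refl
  path-self (leaf k) with leaf k ≟ leaf k
  ... | yes _   = refl
  ... | no  k≢k = ⊥-elim (k≢k refl)

  centre∈viaCentres : ∀ b s k → centre b ∈ viaCentres b s k
  centre∈viaCentres false false k = here refl
  centre∈viaCentres false true  k = here refl
  centre∈viaCentres true  false k = here refl
  centre∈viaCentres true  true  k = here refl

  centre∈pathFromCentre : ∀ b y → centre b ∈ pathFromCentre b y
  centre∈pathFromCentre false c₀       = here refl
  centre∈pathFromCentre false c₁       = here refl
  centre∈pathFromCentre true  c₀       = here refl
  centre∈pathFromCentre true  c₁       = here refl
  centre∈pathFromCentre b     (leaf k) = centre∈viaCentres b (side k) k

  leaf∈viaCentres : ∀ b s k → leaf k ∈ viaCentres b s k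
  leaf∈viaCentres false false k = there (here refl)
  leaf∈viaCentres false true  k = there (there (here refl))
  leaf∈viaCentres true  false k = there (there (here refl))
  leaf∈viaCentres true  true  k = there (here refl)

  viaCentres-cons : ∀ b s k → centre b ∉ viaCentres (not b) s k →
                    viaCentres b s k ≡ centre b ∷ viaCentres (not b) s k
  viaCentres-cons false false k c∉ = ⊥-elim (c∉ (there (here refl)))
  viaCentres-cons false true  k c∉ = refl
  viaCentres-cons true  false k c∉ = refl
  viaCentres-cons true  true  k c∉ = ⊥-elim (c∉ (there (here refl)))

  pathFromCentre-cons : ∀ b y → centre b ∉ pathFromCentre (not b) y →
                        pathFromCentre b y ≡ centre b ∷ pathFromCentre (not b) y
  pathFromCentre-cons false c₀       c∉ = ⊥-elim (c∉ (there (here refl)))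
  pathFromCentre-cons false c₁       c∉ = refl
  pathFromCentre-cons true  c₀       c∉ = refl
  pathFromCentre-cons true  c₁       c∉ = ⊥-elim (c∉ (there (here refl)))
  pathFromCentre-cons b     (leaf k) c∉ = viaCentres-cons b (side k) k c∉

  path-cons : ∀ x x₁ y → Edge x x₁ → x ∉ path x₁ y → path x y ≡ x ∷ path x₁ y
  path-cons c₀ c₁ y _ x∉ = pathFromCentre-cons false y x∉
  path-cons c₁ c₀ y _ x∉ = pathFromCentre-cons true y x∉
  path-cons c₀ (leaf k) y e x∉ with y ≟ leaf k
  ... | yes refl rewrite e = refl
  ... | no  _    rewrite e = ⊥-elim (x∉ (there (centre∈pathFromCentre false y)))
  path-cons c₁ (leaf k) y e x∉ with y ≟ leaf k
  ... | yes refl rewrite e = refl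
  ... | no  _    rewrite e = ⊥-elim (x∉ (there (centre∈pathFromCentre true y)))
  path-cons (leaf k) c₀ y e x∉ with y ≟ leaf k
  ... | yes refl = ⊥-elim (x∉ (leaf∈viaCentres false (side k) k))
  ... | no  _    rewrite e = refl
  path-cons (leaf k) c₁ y e x∉ with y ≟ leaf k
  ... | yes refl = ⊥-elim (x∉ (leaf∈viaCentres true (side k) k))
  ... | no  _    rewrite e = refl

  simplePath≡path : ∀ {x y ps} → Walk Edge x y ps → Unique ps → ps ≡ path x y
  simplePath≡path {x} here _ = sym (path-self x)
  simplePath≡path {x} {y} (step {y = x₁} e w) (x∉ps ∷ u) =
    trans (cong (x ∷_) ps≡path) (sym (path-cons x x₁ y e x∉path))
    where
    ps≡path = simplePath≡path w u
    x∉path : x ∉ path x₁ y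
    x∉path = subst (x ∉_) ps≡path (All.All¬⇒¬Any x∉ps)

  isTree : IsTree (suc ℓ) Edge
  isTree = record
    { symT       = λ {x} {y} → edge-sym {x} {y}
    ; irreflT    = λ {x} → edge-irrefl {x}
    ; connected  = λ x y → path x y , path-walk x y
    ; uniquePath = λ (w , u) (w′ , u′) → trans (simplePath≡path w u) (sym (simplePath≡path w′ u′))
    }

  module _ (P : Node → Set) where

    viaCentres-all : ∀ b s k → P (centre b) → P (leaf k) → P (centre s) → All P (viaCentres b s k)
    viaCentres-all false false k pb pk ps = pb ∷ pk ∷ []
    viaCentres-all false true  k pb pk ps = pb ∷ ps ∷ pk ∷ []
    viaCentres-all true  false k pb pk ps = pb ∷ ps ∷ pk ∷ []
    viaCentres-all true  true  k pb pk ps = pb ∷ pk ∷ []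

    pathFromCentre-all : ∀ b y → P (centre b) → P y → P (parent y) → All P (pathFromCentre b y)
    pathFromCentre-all false c₀       pb py _   = pb ∷ []
    pathFromCentre-all false c₁       pb py _   = pb ∷ py ∷ []
    pathFromCentre-all true  c₀       pb py _   = pb ∷ py ∷ []
    pathFromCentre-all true  c₁       pb py _   = pb ∷ []
    pathFromCentre-all b     (leaf k) pb py ppy = viaCentres-all b (side k) k pb py ppy

    path-all : ∀ x y → P x → P y → P (parent x) → P (parent y) → All P (path x y)
    path-all c₀       y px py _ ppy = pathFromCentre-all false y px py ppy
    path-all c₁       y px py _ ppy = pathFromCentre-all true y px py ppy
    path-all (leaf k) y px py ppx ppy with y ≟ leaf k
    ... | yes _ = px ∷ []
    ... | no  _ = px ∷ pathFromCentre-all (side k) y ppx py ppy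

    simplePath-all : (∀ {x y} → x ≢ y → P x → P y → P (parent x)) →
                     ∀ {x y ps} → SimplePath Edge x y ps → P x → P y → All P ps
    simplePath-all toParent {x} {y} (w , u) px py with x ≟ y
    ... | yes refl = subst (All P) (sym (trans (simplePath≡path w u) (path-self x))) (px ∷ [])
    ... | no  x≢y  = subst (All P) (sym (simplePath≡path w u))
                       (path-all x y px py (toParent x≢y px py) (toParent (x≢y ∘′ sym) py px))

module FiniteSubdivision {n : ℕ} (H : SimpleGraph n) (sub : Fin n → Fin n → Bool) where

  open SimpleGraph H using (adj)

  SubdividedEdge : Fin n → Fin n → Set
  SubdividedEdge u v = u <ᶠ v × adj u v ≡ true × sub u v ≡ true

  subdividedEdge-irrelevant : ∀ {u v} (p q : SubdividedEdge u v) → p ≡ q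
  subdividedEdge-irrelevant (u<v , a , s) (u<v′ , a′ , s′)
    with <-irrelevant u<v u<v′ | Decidable⇒UIP.≡-irrelevant Bool._≟_ a a′
       | Decidable⇒UIP.≡-irrelevant Bool._≟_ s s′
  ... | refl | refl | refl = refl

  subdividedEdge? : ∀ u v → Dec (SubdividedEdge u v)
  subdividedEdge? u v = (u <? v) ×-dec (adj u v Bool.≟ true) ×-dec (sub u v Bool.≟ true)

  _≟ˢ_ : DecidableEquality (SubVertex H sub)
  ((u , v) , p) ≟ˢ ((u′ , v′) , p′) with u ≟ u′ | v ≟ v′
  ... | yes refl | yes refl = yes (cong ((u , v) ,_) (subdividedEdge-irrelevant p p′))
  ... | no  u≢u′ | _        = no (λ e → u≢u′ (cong (proj₁ ∘ proj₁) e))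
  ... | yes _    | no  v≢v′ = no (λ e → v≢v′ (cong (proj₂ ∘ proj₁) e))

  _≟ᵛ_ : DecidableEquality (SubV H sub)
  inj₁ x ≟ᵛ inj₁ y = map′ (cong inj₁) inj₁-injective (x ≟ y)
  inj₁ _ ≟ᵛ inj₂ _ = no (λ ())
  inj₂ _ ≟ᵛ inj₁ _ = no (λ ())
  inj₂ w ≟ᵛ inj₂ z = map′ (cong inj₂) inj₂-injective (w ≟ˢ z)

  subVertexOf : Fin n × Fin n → Maybe (SubVertex H sub)
  subVertexOf (u , v) with subdividedEdge? u v
  ... | yes p = just ((u , v) , p)
  ... | no  _ = nothing

  subVertexOf-proj₁ : ∀ w → subVertexOf (proj₁ w) ≡ just w
  subVertexOf-proj₁ ((u , v) , p) with subdividedEdge? u v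
  ... | yes p′ = cong (λ q → just ((u , v) , q)) (subdividedEdge-irrelevant p′ p)
  ... | no  ¬p = ⊥-elim (¬p p)

  subVertices : List (SubVertex H sub)
  subVertices = mapMaybe subVertexOf (cartesianProduct (allFin n) (allFin n))

  ∈-subVertices : ∀ w → w ∈ subVertices
  ∈-subVertices w = ∈-mapMaybe⁺ {f = subVertexOf} (∈-cartesianProduct⁺ (∈-allFin _) (∈-allFin _)) (subVertexOf-proj₁ w)

  vertices : List (SubV H sub)
  vertices = map inj₁ (allFin n) ++ map inj₂ subVertices

  ∈-vertices : ∀ x → x ∈ vertices
  ∈-vertices (inj₁ x) = ∈-++⁺ˡ (∈-map⁺ inj₁ (∈-allFin x))
  ∈-vertices (inj₂ w) = ∈-++⁺ʳ (map inj₁ (allFin n)) (∈-map⁺ inj₂ (∈-subVertices w))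

  edge? : ∀ x y → Dec (SubE H sub x y)
  edge? (inj₁ u)            (inj₁ v)            = (adj u v Bool.≟ true) ×-dec (sub u v Bool.≟ false)
  edge? (inj₁ x)            (inj₂ ((u , v) , _)) = (x ≟ u) ⊎-dec (x ≟ v)
  edge? (inj₂ ((u , v) , _)) (inj₁ x)            = (x ≟ u) ⊎-dec (x ≟ v)
  edge? (inj₂ _)            (inj₂ _)            = no (λ ())

module Construction {n : ℕ} (H : SimpleGraph n) (sub : Fin n → Fin n → Bool)
                    (sub-sym : ∀ u v → sub u v ≡ sub v u)
                    (O : AcyclicOrientation (subdivide H sub sub-sym)) where

  open AcyclicOrientation O
  open FiniteSubdivision H sub
  open DecMembership (_≟_ {n}) using (_∈?_)
  open DecMembership _≟ᵛ_ using () renaming (_∈?_ to _∈ᵛ?_)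
  open GreedyMatching {E = SubVertex H sub} _≟_ proj₁

  V : Set
  V = SubV H sub

  Source : V → Set
  Source = IsSource O

  arc? : ∀ x y → Dec (D x y)
  arc? x y with edge? x y
  ... | no  ¬xy = no (¬xy ∘ sound)
  ... | yes xy with complete xy
  ...   | inj₁ x→y = yes x→y
  ...   | inj₂ y→x = no (λ x→y → antisym x→y y→x)

  source? : ∀ x → Dec (Source x)
  source? x = map′ (λ all u → All.lookup all (∈-vertices u)) (λ src → All.tabulate (λ {u} _ → src u))
                   (all? (λ u → ¬? (arc? u x)) vertices)

  source⇒arc : ∀ {w x} → Source (inj₂ w) → x ∈ endpoints w → D (inj₂ w) (inj₁ x)
  source⇒arc {w} {x} src x∈w with complete {inj₂ w} {inj₁ x} (edge x∈w)
    where
    edge : x ∈ endpoints w → SubE H sub (inj₂ w) (inj₁ x)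
    edge (here x≡u)         = inj₁ x≡u
    edge (there (here x≡v)) = inj₂ x≡v
  ... | inj₁ w→x = w→x
  ... | inj₂ x→w = ⊥-elim (src _ x→w)

  sourceSubVertices : List (SubVertex H sub)
  sourceSubVertices = filter (source? ∘ inj₂) subVertices

  M : List (SubVertex H sub)
  M = maximalMatching sourceSubVertices

  matched-source : ∀ {m} → m ∈ M → Source (inj₂ m)
  matched-source m∈M =
    proj₂ (∈-filter⁻ (source? ∘ inj₂) {xs = subVertices} (∈-maximalMatching sourceSubVertices m∈M))

  M-maximal : ∀ {w} → Source (inj₂ w) → ¬ Free M w
  M-maximal {w} src =
    maximalMatching-maximal sourceSubVertices (∈-filter⁺ (source? ∘ inj₂) (∈-subVertices w) src)

  covered-arc : ∀ {x} → x ∈ covered M → ∃ λ m → m ∈ M × D (inj₂ m) (inj₁ x)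
  covered-arc x∈M with find (∈-concatMap⁻ endpoints x∈M)
  ... | m , m∈M , x∈m = m , m∈M , source⇒arc (matched-source m∈M) x∈m

  uncovered : List (Fin n)
  uncovered = filter (λ x → ¬? (x ∈? covered M)) (allFin n)

  ∈-uncovered : ∀ {x} → x ∉ covered M → x ∈ uncovered
  ∈-uncovered {x} x∉M = ∈-filter⁺ (λ x → ¬? (x ∈? covered M)) (∈-allFin x) x∉M

  2*matched+uncovered≤n : 2 * length M + length uncovered ≤ n
  2*matched+uncovered≤n = subst (_≤ n) length≡ (length-unique-Fin covered++uncovered-unique)
    where
    covered++uncovered-unique : Unique (covered M ++ uncovered)
    covered++uncovered-unique =
      Unique.++⁺ (maximalMatching-unique sourceSubVertices (All.tabulate (λ {w} _ → <⇒≢ (proj₁ (proj₂ w)))))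
                 (Unique.filter⁺ (λ x → ¬? (x ∈? covered M)) (Unique.allFin⁺ n))
                 (λ (x∈M , x∈U) → proj₂ (∈-filter⁻ (λ x → ¬? (x ∈? covered M)) {xs = allFin n} x∈U) x∈M)
    length≡ : length (covered M ++ uncovered) ≡ 2 * length M + length uncovered
    length≡ = trans (length-++ (covered M)) (cong (_+ length uncovered) (length-covered M))

  side : Fin n → Bool
  side x = does (x ∈? everyOther true uncovered)

  ∈-side : ∀ {x} → x ∉ covered M → x ∈ everyOther (side x) uncovered
  ∈-side {x} x∉M with x ∈? everyOther true uncovered
  ... | yes x∈true = x∈true
  ... | no  x∉true = [ ⊥-elim ∘ x∉true , id ]′ (∈-everyOther (∈-uncovered x∉M))

  Feeds : V → Fin n → Set
  Feeds s x = s ≡ inj₁ x ⊎ D s (inj₁ x)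

  FeedingSource : Fin n → V → Set
  FeedingSource x s = Source s × Feeds s x

  feeds⇒star : ∀ {s x} → Feeds s x → Star D s (inj₁ x)
  feeds⇒star (inj₁ refl) = ε
  feeds⇒star (inj₂ s→x)  = s→x ◅ ε

  feedingSource? : ∀ x → Dec (∃ (FeedingSource x))
  feedingSource? x = map′ Any.satisfied (λ (s , p) → lose (∈-vertices s) p)
                          (any? (λ s → source? s ×-dec (s ≟ᵛ inj₁ x ⊎-dec arc? s (inj₁ x))) vertices)

  representative : Fin n → Maybe V
  representative x with feedingSource? x
  ... | yes (s , _) = just s
  ... | no  _       = nothing

  representative-source : ∀ x → MaybeAll.All Source (representative x)
  representative-source x with feedingSource? x
  ... | yes (_ , src , _) = MaybeAll.just src
  ... | no  _             = MaybeAll.nothing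

  representative-complete : ∀ {x s} → FeedingSource x s →
                            ∃ λ s′ → representative x ≡ just s′ × FeedingSource x s′
  representative-complete {x} fs with feedingSource? x
  ... | yes (s′ , fs′) = s′ , refl , fs′
  ... | no  ¬fs        = ⊥-elim (¬fs (_ , fs))

  centreBag : Bool → List V
  centreBag b = deduplicate _≟ᵛ_ (map inj₂ M ++ mapMaybe representative (everyOther b uncovered))

  centreBag-sources : ∀ b → All Source (centreBag b)
  centreBag-sources b = All.deduplicate⁺ _≟ᵛ_ (All.++⁺ (All.map⁺ (All.tabulate matched-source))
                          (All.mapMaybe⁺ {xs = everyOther b uncovered} {f = representative}
                            (All.map⁺ (All.tabulate (λ {x} _ → representative-source x)))))

  length-centreBag : ∀ b → length (centreBag b) ≤ ⌈ n /2⌉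
  length-centreBag b = begin
    length (centreBag b)                            ≤⟨ length-deduplicate _≟ᵛ_ (map inj₂ M ++ reps) ⟩
    length (map inj₂ M ++ reps)                     ≡⟨ length-++ (map inj₂ M) ⟩
    length (map inj₂ M) + length reps               ≡⟨ cong (_+ length reps) (length-map inj₂ M) ⟩
    length M + length reps                          ≤⟨ +-monoʳ-≤ (length M) (length-mapMaybe representative half) ⟩
    length M + length half                          ≤⟨ +-monoʳ-≤ (length M) (length-everyOther b uncovered) ⟩
    length M + ⌈ length uncovered /2⌉              ≡⟨ ⌈2*m+n/2⌉≡m+⌈n/2⌉ (length M) (length uncovered) ⟨
    ⌈ 2 * length M + length uncovered /2⌉          ≤⟨ ⌈n/2⌉-mono 2*matched+uncovered≤n ⟩
    ⌈ n /2⌉                                         ∎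
    where
    open ≤-Reasoning
    half = everyOther b uncovered
    reps = mapMaybe representative half

  matched∈centreBag : ∀ {m} b → m ∈ M → inj₂ m ∈ centreBag b
  matched∈centreBag b m∈M = ∈-deduplicate⁺ _≟ᵛ_ (∈-++⁺ˡ (∈-map⁺ inj₂ m∈M))

  covered-reachable : ∀ {x} b → x ∈ covered M → InR O (centreBag b) (inj₁ x)
  covered-reachable b x∈M with covered-arc x∈M
  ... | m , m∈M , m→x = inj₂ m , matched∈centreBag b m∈M , m→x ◅ ε

  representative∈centreBag : ∀ {x s} → x ∉ covered M → FeedingSource x s →
                             ∃ λ s′ → s′ ∈ centreBag (side x) × FeedingSource x s′
  representative∈centreBag x∉M fs with representative-complete fs
  ... | s′ , rep≡s′ , fs′ =
    s′ , ∈-deduplicate⁺ _≟ᵛ_ (∈-++⁺ʳ (map inj₂ M) (∈-mapMaybe⁺ (∈-side x∉M) rep≡s′)) , fs′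

  uncovered-reachable : ∀ {x s} → x ∉ covered M → FeedingSource x s → InR O (centreBag (side x)) (inj₁ x)
  uncovered-reachable x∉M fs with representative∈centreBag x∉M fs
  ... | s′ , s′∈ , (_ , s′↦x) = s′ , s′∈ , feeds⇒star s′↦x

  fed-by-source : ∀ {s x} → Source (inj₁ x) → Feeds s x → s ≡ inj₁ x
  fed-by-source src (inj₁ s≡x) = s≡x
  fed-by-source src (inj₂ s→x) = ⊥-elim (src _ s→x)

  source∈centreBag : ∀ {x} → Source (inj₁ x) → inj₁ x ∈ centreBag (side x)
  source∈centreBag {x} src =
    let s , s∈ , (_ , s↦x) = representative∈centreBag x∉M (src , inj₁ refl)
    in subst (_∈ centreBag (side x)) (fed-by-source src s↦x) s∈
    where
    x∉M : x ∉ covered M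
    x∉M x∈M = let _ , _ , m→x = covered-arc x∈M in src _ m→x

  leafSide : SubVertex H sub → Bool
  leafSide ((u , v) , _) = if does (u ∈? covered M) then side v else side u

  leafSide≡side : ∀ {w x} → Source (inj₂ w) → x ∈ endpoints w → x ∉ covered M → leafSide w ≡ side x
  leafSide≡side {(u , v) , _} src (here refl) u∉M with u ∈? covered M
  ... | yes u∈M = ⊥-elim (u∉M u∈M)
  ... | no  _   = refl
  leafSide≡side {(u , v) , _} src (there (here refl)) v∉M with u ∈? covered M
  ... | yes _   = refl
  ... | no  u∉M = ⊥-elim (M-maximal src (u∉M ∷ v∉M ∷ []))

  endpoint-reachable : ∀ {w x} → Source (inj₂ w) → x ∈ endpoints w → InR O (centreBag (leafSide w)) (inj₁ x)
  endpoint-reachable {w} {x} src x∈w with x ∈? covered M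
  ... | yes x∈M = covered-reachable (leafSide w) x∈M
  ... | no  x∉M rewrite leafSide≡side src x∈w x∉M =
    uncovered-reachable x∉M (src , inj₂ (source⇒arc src x∈w))

  shared-reach : ∀ {w s v} → Source (inj₂ w) → Star D (inj₂ w) v → Star D s v →
                 s ≡ inj₂ w ⊎ InR O (centreBag (leafSide w)) v
  shared-reach src ε s⇝w = inj₁ (star-into-minimal src s⇝w)
  shared-reach {w} src (_◅_ {j = inj₁ x} w→x x⇝v) _ with endpoint-reachable src (endpoint (sound w→x))
    where
    endpoint : SubE H sub (inj₂ w) (inj₁ x) → x ∈ endpoints w
    endpoint (inj₁ x≡u) = here x≡u
    endpoint (inj₂ x≡v) = there (here x≡v)
  ... | s , s∈ , s⇝x = inj₂ (s , s∈ , s⇝x ◅◅ x⇝v)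
  shared-reach src (_◅_ {j = inj₂ _} w→z _) _ = ⊥-elim (sound w→z)

  -- Sources already in a central bag get no leaf, so a leaf's source lies in no other bag.
  IsLeaf : SubVertex H sub → Set
  IsLeaf w = Source (inj₂ w) × inj₂ w ∉ centreBag false × inj₂ w ∉ centreBag true

  isLeaf? : ∀ w → Dec (IsLeaf w)
  isLeaf? w = source? (inj₂ w) ×-dec ¬? (inj₂ w ∈ᵛ? centreBag false) ×-dec ¬? (inj₂ w ∈ᵛ? centreBag true)

  leaves : List (SubVertex H sub)
  leaves = deduplicate _≟ˢ_ (filter isLeaf? subVertices)

  leafAt : Fin (length leaves) → SubVertex H sub
  leafAt = lookup leaves

  leafAt-isLeaf : ∀ k → IsLeaf (leafAt k)
  leafAt-isLeaf k = proj₂ (∈-filter⁻ isLeaf? {xs = subVertices} (∈-deduplicate⁻ _≟ˢ_ _ (∈-lookup k)))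

  ∈-leaves : ∀ {w} → IsLeaf w → w ∈ leaves
  ∈-leaves {w} leaf = ∈-deduplicate⁺ _≟ˢ_ (∈-filter⁺ isLeaf? (∈-subVertices w) leaf)

  open DoubleStar (leafSide ∘ leafAt)

  bag : Node → List V
  bag c₀       = centreBag false
  bag c₁       = centreBag true
  bag (leaf k) = inj₂ (leafAt k) ∷ []

  bag-centre : ∀ b → bag (centre b) ≡ centreBag b
  bag-centre false = refl
  bag-centre true  = refl

  leafAt∈bag : ∀ k j → inj₂ (leafAt k) ∈ bag j → j ≡ leaf k
  leafAt∈bag k c₀        k∈ = ⊥-elim (proj₁ (proj₂ (leafAt-isLeaf k)) k∈)
  leafAt∈bag k c₁        k∈ = ⊥-elim (proj₂ (proj₂ (leafAt-isLeaf k)) k∈)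
  leafAt∈bag k (leaf k′) (here k≡k′) =
    cong leaf (lookup-injective (deduplicate-! _≟ˢ_ (filter isLeaf? subVertices)) k′ k (sym (inj₂-injective k≡k′)))

  reach-parent : ∀ {v i j} → i ≢ j → InR O (bag i) v → InR O (bag j) v → InR O (bag (parent i)) v
  reach-parent {i = c₀} _ r _ = r
  reach-parent {i = c₁} _ r _ = r
  reach-parent {v} {leaf k} {j} k≢j (_ , here refl , w⇝v) (s , s∈j , s⇝v) =
    [ (λ s≡w → ⊥-elim (k≢j (sym (leafAt∈bag k j (subst (_∈ bag j) s≡w s∈j)))))
    , subst (λ B → InR O B v) (sym (bag-centre (leafSide (leafAt k))))
    ]′ (shared-reach (proj₁ (leafAt-isLeaf k)) w⇝v s⇝v)

  cover : ∀ s → Source s → ∃ λ i → s ∈ bag i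
  cover (inj₁ x) src = centre (side x) , subst (inj₁ x ∈_) (sym (bag-centre (side x))) (source∈centreBag src)
  cover (inj₂ w) src = centreOrLeaf (inj₂ w ∈ᵛ? centreBag false) (inj₂ w ∈ᵛ? centreBag true)
    where
    centreOrLeaf : Dec (inj₂ w ∈ centreBag false) → Dec (inj₂ w ∈ centreBag true) → ∃ λ i → inj₂ w ∈ bag i
    centreOrLeaf (yes w∈) _        = c₀ , w∈
    centreOrLeaf (no  _)  (yes w∈) = c₁ , w∈
    centreOrLeaf (no  w∉) (no w∉′) = leaf (index w∈) , here (cong inj₂ (lookup-index w∈))
      where
      w∈ : w ∈ leaves
      w∈ = ∈-leaves (src , w∉ , w∉′)

  bag-unique : ∀ i → Unique (bag i)
  bag-unique c₀       = deduplicate-! _≟ᵛ_ _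
  bag-unique c₁       = deduplicate-! _≟ᵛ_ _
  bag-unique (leaf k) = [] ∷ []

  bag-sources : ∀ i → All Source (bag i)
  bag-sources c₀       = centreBag-sources false
  bag-sources c₁       = centreBag-sources true
  bag-sources (leaf k) = proj₁ (leafAt-isLeaf k) ∷ []

  decomposition : DAGTreeDecomposition O
  decomposition = record
    { t        = suc (length leaves)
    ; T        = Edge
    ; isTree   = isTree
    ; bag      = bag
    ; bagUniq  = bag-unique
    ; bagSrc   = bag-sources
    ; cover    = cover
    ; pathCond = λ i j l ps p l∈p v r₁ r₂ →
        All.lookup (simplePath-all (λ l → InR O (bag l) v) (reach-parent {v}) p r₁ r₂) l∈p
    }

  width : WidthAtMost O decomposition ⌈ n /2⌉
  width c₀       = length-centreBag false
  width c₁       = length-centreBag true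
  width (leaf k) = 1≤⌈n/2⌉ (proj₁ (proj₁ (leafAt k)))

mainTheorem19 : (n : ℕ) (H : SimpleGraph n) (sub : Fin n → Fin n → Bool)
    (sub-sym : ∀ u v → sub u v ≡ sub v u) →
    DtwAtMost (subdivide H sub sub-sym) ⌈ n /2⌉
mainTheorem19 n H sub sub-sym O = decomposition , width
  where open Construction H sub sub-sym O
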